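{- Let $n\geq 2$ be an integer. For $x\in\{2,\ldots,n\}$ write $n-x=a(x-1)+r$ with $a\in\mathbb{N}_0$ and $0\leq r<x-1$ (division with remainder), and call $x$ feasible if $x\geq a$ when $r=0$ and $x\geq a+1$ when $r\neq 0$. Then $$\min\left\{\|\lambda\|_2^2 : \lambda\in\mathcal{P}(n),\ \operatorname{rank}(\lambda)\geq 0\right\} = \min\left\{x^{2}+r(a+1)^{2}+(x-1-r)a^{2} : x\in\{2,\ldots,n\} \text{ feasible}\right\},$$ that is, the problem of minimizing $\|\lambda\|_2^2$ over partitions of $n$ of nonnegative rank is equivalent to minimizing $x^{2}+r(a+1)^{2}+(x-1-r)a^{2}$ over feasible $x$.
   Context: $\mathcal{P}(n)$ denotes the set of partitions of $n$, i.e., nonincreasing finite sequences $\lambda=(\lambda_1,\ldots,\lambda_k)$ of positive integers with sum $n$. For such $\lambda$, $\|\lambda\|_2^2=\sum_i \lambda_i^2$, and the rank of $\lambda$ is $\operatorname{rank}(\lambda)=\lambda_1-k$ (largest part minus number of parts). $\mathbb{N}_0$ is the set of nonnegative integers. -}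

module Defs where

open import Data.Nat using (ℕ; zero; suc; _+_; _*_; _∸_; _^_; _≤_; _<_)
open import Data.Nat.DivMod using (_/_; _%_)
open import Data.Integer using (ℤ; +_; _-_; _≥_; 0ℤ)
open import Data.List using (List; []; _∷_; length; map)
open import Data.Nat.ListAction using (sum)
open import Data.List.Relation.Unary.All using (All)
open import Data.List.Relation.Unary.Linked using (Linked)
open import Data.Product using (Σ; _×_)
open import Relation.Binary.PropositionalEquality using (_≡_)

record IsPartition (n : ℕ) (λs : List ℕ) : Set where
  field
    positive    : All (λ p → 0 < p) λs
    nonincrease : Linked (λ a b → b ≤ a) λs
    sums        : sum λs ≡ n

normSq : List ℕ → ℕ
normSq λs = sum (map (λ p → p * p) λs)

largest : List ℕ → ℕ
largest []      = 0
largest (p ∷ _) = p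

rank : List ℕ → ℤ
rank λs = + largest λs - + length λs

-- For x ≥ 2 (written x = suc (suc y), so x − 1 = suc y is nonzero):
-- n − x = a (x − 1) + r  with 0 ≤ r < x − 1.
quotA : ℕ → ℕ → ℕ
quotA n (suc (suc y)) = (n ∸ suc (suc y)) / suc y
quotA n _             = 0

remR : ℕ → ℕ → ℕ
remR n (suc (suc y)) = (n ∸ suc (suc y)) % suc y
remR n _             = 0

feasibleAux : ℕ → ℕ → ℕ → Set
feasibleAux x a zero    = a ≤ x
feasibleAux x a (suc _) = a + 1 ≤ x

Feasible : ℕ → ℕ → Set
Feasible n x = feasibleAux x (quotA n x) (remR n x)

cost : ℕ → ℕ → ℕ
cost n x = x ^ 2 + r * (a + 1) ^ 2 + (x ∸ 1 ∸ r) * a ^ 2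
  where
    a = quotA n x
    r = remR n x

IsMinimum : {A : Set} → (A → Set) → (A → ℕ) → ℕ → Set
IsMinimum {A} S f m = Σ A (λ s → S s × f s ≡ m) × (∀ s → S s → m ≤ f s)

{-# OPTIONS --safe #-}
-- Each part l satisfies l² ≥ (2a + 1) l − a (a + 1), the chord of the parabola through a and a + 1.
-- If λ has largest part x and nonnegative rank, its other parts are at most x − 1 in number and
-- sum to n − x = a (x − 1) + r, so summing this bound gives ‖λ‖² ≥ cost x; since those parts are
-- at most x, x is feasible. Conversely, for feasible x the partition (x, (a + 1)^r, a^(x − 1 − r))
-- has nonnegative rank and squared norm exactly cost x. The cost minimum exists since the feasible
-- x form a nonempty subset of {2, …, n}.
module Submission where

open import Defs
open import Data.Nat using (ℕ; _≤_)
open import Data.Integer using (0ℤ) renaming (_≤_ to _≤ℤ_)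
open import Data.List using (List)
open import Data.Product using (Σ; _×_)

open import Data.Integer using (+≤+)
import Data.Integer.Properties as ℤ
open import Data.List using ([]; _∷_; _++_; length; map; replicate; filter; upTo)
open import Data.List.Extrema.Nat using (argmin; argmin-all; f[argmin]≤f[xs])
open import Data.List.Membership.Propositional.Properties using (∈-upTo⁺; ∈-filter⁺)
open import Data.List.Properties using (length-++; length-replicate; map-++; map-replicate)
open import Data.List.Relation.Unary.All as All using (All; []; _∷_)
open import Data.List.Relation.Unary.All.Properties using (++⁺; replicate⁺; all-filter)
open import Data.List.Relation.Unary.Linked using (Linked; []; [-]; _∷_)
open import Data.List.Relation.Unary.Linked.Properties using (Linked⇒All)
open import Data.Nat using (zero; suc; _+_; _*_; _∸_; _^_; _<_; _≥_; _≤?_; z≤n; s≤s; NonZero)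
open import Data.Nat.DivMod using (m≡m%n+[m/n]*n; m%n<n)
open import Data.Nat.ListAction using (sum)
open import Data.Nat.ListAction.Properties using (sum-++)
open import Data.Nat.Properties
open import Algebra.Properties.CommutativeSemigroup +-commutativeSemigroup using (interchange)
open import Data.Nat.Tactic.RingSolver using (solve-∀)
open import Data.Product using (_,_; proj₁; proj₂; ∃-syntax)
open import Function using (_∘_)
open import Relation.Binary.PropositionalEquality using (_≡_; refl; sym; trans; cong; cong₂; subst; module ≡-Reasoning)
open import Relation.Nullary using (Dec; contradiction)
open import Relation.Nullary.Decidable using (_×-dec_)
open import Relation.Unary using (Decidable)

square : ∀ m → m ^ 2 ≡ m * m
square m = cong (m *_) (*-identityʳ m)

-- This is (l − a)(l − a − 1) ≥ 0; raising a and l by one adds 2a + 2l + 3 to both sides.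
chord-bound : ∀ a l → (2 * a + 1) * l ≤ l * l + a * (a + 1)
chord-bound a       zero    = subst (_≤ a * (a + 1)) (sym (*-zeroʳ (2 * a + 1))) z≤n
chord-bound zero    (suc l) = +-monoˡ-≤ 0 (m≤m*n (suc l) (suc l))
chord-bound (suc a) (suc l) = begin
  (2 * suc a + 1) * suc l                    ≡⟨ expand-left a l ⟩
  (2 * a + 1) * l + (2 * a + 2 * l + 3)      ≤⟨ +-monoˡ-≤ (2 * a + 2 * l + 3) (chord-bound a l) ⟩
  l * l + a * (a + 1) + (2 * a + 2 * l + 3)  ≡⟨ expand-right a l ⟨
  suc l * suc l + suc a * (suc a + 1)        ∎
  where
  open ≤-Reasoning
  expand-left : ∀ a l → (2 * suc a + 1) * suc l ≡ (2 * a + 1) * l + (2 * a + 2 * l + 3)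
  expand-left = solve-∀
  expand-right : ∀ a l → suc l * suc l + suc a * (suc a + 1) ≡ l * l + a * (a + 1) + (2 * a + 2 * l + 3)
  expand-right = solve-∀

sum-chord-bound : ∀ a ls → (2 * a + 1) * sum ls ≤ normSq ls + length ls * (a * (a + 1))
sum-chord-bound a []       = subst (_≤ 0) (sym (*-zeroʳ (2 * a + 1))) z≤n
sum-chord-bound a (l ∷ ls) = begin
  (2 * a + 1) * (l + sum ls)                   ≡⟨ *-distribˡ-+ (2 * a + 1) l (sum ls) ⟩
  (2 * a + 1) * l + (2 * a + 1) * sum ls       ≤⟨ +-mono-≤ (chord-bound a l) (sum-chord-bound a ls) ⟩
  l * l + c + (normSq ls + length ls * c)      ≡⟨ interchange (l * l) c (normSq ls) (length ls * c) ⟩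
  l * l + normSq ls + (c + length ls * c)      ∎
  where
  open ≤-Reasoning
  c = a * (a + 1)

-- The chord bound at a is an equality at a and a + 1, so summing it is sharp for the list
-- with r parts a + 1 and k parts a.
balanced-≤-normSq : ∀ r k a ls → sum ls ≡ r + a * (r + k) → length ls ≤ r + k →
                    r * (a + 1) ^ 2 + k * a ^ 2 ≤ normSq ls
balanced-≤-normSq r k a ls sum≡ length≤ = +-cancelʳ-≤ ((r + k) * c) _ _ (begin
  r * (a + 1) ^ 2 + k * a ^ 2 + (r + k) * c  ≡⟨ identity ⟩
  (2 * a + 1) * (r + a * (r + k))           ≡⟨ cong ((2 * a + 1) *_) sum≡ ⟨
  (2 * a + 1) * sum ls                       ≤⟨ sum-chord-bound a ls ⟩
  normSq ls + length ls * c                  ≤⟨ +-monoʳ-≤ (normSq ls) (*-monoˡ-≤ c length≤) ⟩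
  normSq ls + (r + k) * c                    ∎)
  where
  open ≤-Reasoning
  c = a * (a + 1)
  identity : r * (a + 1) ^ 2 + k * a ^ 2 + (r + k) * c ≡ (2 * a + 1) * (r + a * (r + k))
  identity rewrite square (a + 1) | square a = expand a r k
    where
    expand : ∀ a r k → r * ((a + 1) * (a + 1)) + k * (a * a) + (r + k) * (a * (a + 1))
                     ≡ (2 * a + 1) * (r + a * (r + k))
    expand = solve-∀

sum-≤-length*bound : ∀ {x} ls → All (_≤ x) ls → sum ls ≤ length ls * x
sum-≤-length*bound []       []          = z≤n
sum-≤-length*bound (l ∷ ls) (l≤x ∷ ls≤x) = +-mono-≤ l≤x (sum-≤-length*bound ls ls≤x)

feasibleAux-intro : ∀ {x a} r q .{{_ : NonZero q}} → r + a * q ≤ q * x → feasibleAux x a r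
feasibleAux-intro {x} {a} zero    q bound = *-cancelʳ-≤ a x q (subst (a * q ≤_) (*-comm q x) bound)
feasibleAux-intro {x} {a} (suc r) q bound = subst (_≤ x) (+-comm 1 a)
  (*-cancelʳ-< q a x (<-≤-trans (s≤s (m≤n+m (a * q) r)) (subst (suc r + a * q ≤_) (*-comm q x) bound)))

0≤rank⇒length≤largest : ∀ λs → 0ℤ ≤ℤ rank λs → length λs ≤ largest λs
0≤rank⇒length≤largest λs = ℤ.drop‿+≤+ ∘ ℤ.0≤i-j⇒j≤i

length≤largest⇒0≤rank : ∀ λs → length λs ≤ largest λs → 0ℤ ≤ℤ rank λs
length≤largest⇒0≤rank λs = ℤ.i≤j⇒0≤j-i ∘ +≤+

∷-nonincreasing : ∀ {x ys} → All (_≤ x) ys → Linked _≥_ ys → Linked _≥_ (x ∷ ys)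
∷-nonincreasing []        _   = [-]
∷-nonincreasing (y≤x ∷ _) ys↓ = y≤x ∷ ys↓

replicate-nonincreasing : ∀ r b → Linked _≥_ (replicate r b)
replicate-nonincreasing zero    b = []
replicate-nonincreasing (suc r) b = ∷-nonincreasing (replicate⁺ r ≤-refl) (replicate-nonincreasing r b)

sum-replicate : ∀ r b → sum (replicate r b) ≡ r * b
sum-replicate zero    b = refl
sum-replicate (suc r) b = cong (b +_) (sum-replicate r b)

normSq-replicate : ∀ r b → normSq (replicate r b) ≡ r * (b * b)
normSq-replicate r b = trans (cong sum (map-replicate (λ p → p * p) r b)) (sum-replicate r (b * b))

normSq-++ : ∀ xs ys → normSq (xs ++ ys) ≡ normSq xs + normSq ys
normSq-++ xs ys = trans (cong sum (map-++ (λ p → p * p) xs ys)) (sum-++ (map (λ p → p * p) xs) _)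

-- Copies of a zero part are dropped, so that the list remains a partition.
copiesOf : ℕ → ℕ → List ℕ
copiesOf k zero        = []
copiesOf k a@(suc _)   = replicate k a

balanced : ℕ → ℕ → ℕ → List ℕ
balanced r k a = replicate r (a + 1) ++ copiesOf k a

sum-balanced : ∀ r k a → sum (balanced r k a) ≡ r + a * (r + k)
sum-balanced r k a = begin
  sum (balanced r k a)                      ≡⟨ sum-++ (replicate r (a + 1)) (copiesOf k a) ⟩
  sum (replicate r (a + 1)) + sum (copiesOf k a) ≡⟨ cong₂ _+_ (sum-replicate r (a + 1)) (sum-copiesOf a) ⟩
  r * (a + 1) + k * a                       ≡⟨ regroup r k a ⟩
  r + a * (r + k)                           ∎
  where
  open ≡-Reasoning
  regroup : ∀ r k a → r * (a + 1) + k * a ≡ r + a * (r + k)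
  regroup = solve-∀
  sum-copiesOf : ∀ a → sum (copiesOf k a) ≡ k * a
  sum-copiesOf zero    = sym (*-zeroʳ k)
  sum-copiesOf (suc a) = sum-replicate k (suc a)

normSq-balanced : ∀ r k a → normSq (balanced r k a) ≡ r * (a + 1) ^ 2 + k * a ^ 2
normSq-balanced r k a = begin
  normSq (balanced r k a)                               ≡⟨ normSq-++ (replicate r (a + 1)) (copiesOf k a) ⟩
  normSq (replicate r (a + 1)) + normSq (copiesOf k a)  ≡⟨ cong₂ _+_ (normSq-replicate r (a + 1)) (normSq-copiesOf a) ⟩
  r * ((a + 1) * (a + 1)) + k * (a * a)                  ≡⟨ cong₂ (λ u v → r * u + k * v) (square (a + 1)) (square a) ⟨
  r * (a + 1) ^ 2 + k * a ^ 2                            ∎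
  where
  open ≡-Reasoning
  normSq-copiesOf : ∀ a → normSq (copiesOf k a) ≡ k * (a * a)
  normSq-copiesOf zero    = sym (*-zeroʳ k)
  normSq-copiesOf (suc a) = normSq-replicate k (suc a)

length-balanced : ∀ r k a → length (balanced r k a) ≤ r + k
length-balanced r k a = begin
  length (balanced r k a)                            ≡⟨ length-++ (replicate r (a + 1)) ⟩
  length (replicate r (a + 1)) + length (copiesOf k a) ≡⟨ cong (_+ length (copiesOf k a)) (length-replicate r) ⟩
  r + length (copiesOf k a)                          ≤⟨ +-monoʳ-≤ r (length-copiesOf a) ⟩
  r + k                                              ∎
  where
  open ≤-Reasoning
  length-copiesOf : ∀ a → length (copiesOf k a) ≤ k
  length-copiesOf zero    = z≤n
  length-copiesOf (suc a) = ≤-reflexive (length-replicate k)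

balanced-positive : ∀ r k a → All (0 <_) (balanced r k a)
balanced-positive r k a = ++⁺ (replicate⁺ r (m≤n+m 1 a)) (copiesOf-positive a)
  where
  copiesOf-positive : ∀ a → All (0 <_) (copiesOf k a)
  copiesOf-positive zero    = []
  copiesOf-positive (suc a) = replicate⁺ k (s≤s z≤n)

balanced-≤ : ∀ {x a} r k → feasibleAux x a r → All (_≤ x) (balanced r k a)
balanced-≤ {x} {a} r k feasible = ++⁺ (replicate-≤ r feasible) (copiesOf-≤ (a≤x r feasible))
  where
  a≤x : ∀ r → feasibleAux x a r → a ≤ x
  a≤x zero    a≤x   = a≤x
  a≤x (suc r) a+1≤x = ≤-trans (m≤m+n a 1) a+1≤x
  replicate-≤ : ∀ r → feasibleAux x a r → All (_≤ x) (replicate r (a + 1))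
  replicate-≤ zero    _     = []
  replicate-≤ (suc r) a+1≤x = replicate⁺ (suc r) a+1≤x
  copiesOf-≤ : ∀ {a} → a ≤ x → All (_≤ x) (copiesOf k a)
  copiesOf-≤ {zero}  _   = []
  copiesOf-≤ {suc _} a≤x = replicate⁺ k a≤x

balanced-nonincreasing : ∀ r k a → Linked _≥_ (balanced r k a)
balanced-nonincreasing zero    k zero    = []
balanced-nonincreasing zero    k (suc a) = replicate-nonincreasing k (suc a)
balanced-nonincreasing (suc r) k a       =
  ∷-nonincreasing (balanced-≤ r k (feasible-at-a+1 r)) (balanced-nonincreasing r k a)
  where
  feasible-at-a+1 : ∀ r → feasibleAux (a + 1) a r
  feasible-at-a+1 zero    = m≤m+n a 1
  feasible-at-a+1 (suc _) = ≤-refl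

peak-balanced-partition : ∀ {x} r k a → r + k < x → feasibleAux x a r →
  IsPartition (x + (r + a * (r + k))) (x ∷ balanced r k a) × 0ℤ ≤ℤ rank (x ∷ balanced r k a)
peak-balanced-partition {x} r k a r+k<x feasible =
  partition , length≤largest⇒0≤rank (x ∷ balanced r k a) parts<x
  where
  parts<x : suc (length (balanced r k a)) ≤ x
  parts<x = ≤-trans (s≤s (length-balanced r k a)) r+k<x
  partition : IsPartition (x + (r + a * (r + k))) (x ∷ balanced r k a)
  partition = record
    { positive    = ≤-trans (s≤s z≤n) parts<x ∷ balanced-positive r k a
    ; nonincrease = ∷-nonincreasing (balanced-≤ r k feasible) (balanced-nonincreasing r k a)
    ; sums        = cong (x +_) (sum-balanced r k a)
    }

NonnegRankPartition : ℕ → List ℕ → Set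
NonnegRankPartition n λs = IsPartition n λs × 0ℤ ≤ℤ rank λs

FeasibleIn : ℕ → ℕ → Set
FeasibleIn n x = (2 ≤ x × x ≤ n) × Feasible n x

-- n − x = r + a q with q = x − 1 and x = 2 + y; k = q − r is the number of parts equal to a.
module DivisionAt (n y : ℕ) where

  x q a r k : ℕ
  x = suc (suc y)
  q = suc y
  a = quotA n x
  r = remR n x
  k = q ∸ r

  r+k≡q : r + k ≡ q
  r+k≡q = m+[n∸m]≡n (<⇒≤ (m%n<n (n ∸ x) q))

  n∸x≡r+a*q : n ∸ x ≡ r + a * q
  n∸x≡r+a*q = m≡m%n+[m/n]*n (n ∸ x) q

  n∸x≡r+a*[r+k] : n ∸ x ≡ r + a * (r + k)
  n∸x≡r+a*[r+k] = trans n∸x≡r+a*q (cong (λ q → r + a * q) (sym r+k≡q))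

  cost≡ : cost n x ≡ x * x + (r * (a + 1) ^ 2 + k * a ^ 2)
  cost≡ = trans (+-assoc (x ^ 2) _ _) (cong (_+ (r * (a + 1) ^ 2 + k * a ^ 2)) (square x))

partition-of-cost : ∀ n x → FeasibleIn n x → ∃[ λs ] NonnegRankPartition n λs × normSq λs ≡ cost n x
partition-of-cost n (suc zero)    ((s≤s () , _) , _)
partition-of-cost n (suc (suc y)) ((_ , x≤n) , feasible) =
  x ∷ balanced r k a ,
  subst (λ m → NonnegRankPartition m (x ∷ balanced r k a)) x+[n∸x]≡n partition ,
  normSq≡
  where
  open DivisionAt n y
  partition = peak-balanced-partition r k a (subst (_< x) (sym r+k≡q) ≤-refl) feasible
  x+[n∸x]≡n : x + (r + a * (r + k)) ≡ n
  x+[n∸x]≡n = trans (cong (x +_) (sym n∸x≡r+a*[r+k])) (m+[n∸m]≡n x≤n)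
  normSq≡ : normSq (x ∷ balanced r k a) ≡ cost n x
  normSq≡ = trans (cong (x * x +_) (normSq-balanced r k a)) (sym cost≡)

peak-cost-≤-normSq : ∀ {n} → 2 ≤ n → ∀ x t → suc (length t) ≤ x → x + sum t ≡ n → All (_≤ x) t →
                     ∃[ x′ ] FeasibleIn n x′ × cost n x′ ≤ normSq (x ∷ t)
peak-cost-≤-normSq (s≤s ()) (suc zero) []      _         refl _
peak-cost-≤-normSq _        (suc zero) (_ ∷ _) (s≤s ()) _    _
peak-cost-≤-normSq {n} _ (suc (suc y)) t length<x x+sum≡n t≤x =
  x , ((s≤s (s≤s z≤n) , x≤n) , feasible) , cost≤
  where
  open DivisionAt n y
  x≤n : x ≤ n
  x≤n = subst (x ≤_) x+sum≡n (m≤m+n x (sum t))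
  sum≡n∸x : sum t ≡ n ∸ x
  sum≡n∸x = trans (sym (m+n∸m≡n x (sum t))) (cong (_∸ x) x+sum≡n)
  length≤q : length t ≤ q
  length≤q = ≤-pred length<x
  feasible : Feasible n x
  feasible = feasibleAux-intro r q (begin
    r + a * q      ≡⟨ trans sum≡n∸x n∸x≡r+a*q ⟨
    sum t          ≤⟨ sum-≤-length*bound t t≤x ⟩
    length t * x   ≤⟨ *-monoˡ-≤ x length≤q ⟩
    q * x          ∎)
    where open ≤-Reasoning
  cost≤ : cost n x ≤ normSq (x ∷ t)
  cost≤ = subst (_≤ normSq (x ∷ t)) (sym cost≡) (+-monoʳ-≤ (x * x)
    (balanced-≤-normSq r k a t (trans sum≡n∸x n∸x≡r+a*[r+k])
                               (subst (length t ≤_) (sym r+k≡q) length≤q)))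

cost-≤-normSq : ∀ {n} → 2 ≤ n → ∀ λs → NonnegRankPartition n λs →
                ∃[ x ] FeasibleIn n x × cost n x ≤ normSq λs
cost-≤-normSq 2≤n [] (partition , _) = contradiction (subst (2 ≤_) (sym (IsPartition.sums partition)) 2≤n) λ ()
cost-≤-normSq 2≤n (x ∷ t) (partition , 0≤rank) =
  peak-cost-≤-normSq 2≤n x t (0≤rank⇒length≤largest (x ∷ t) 0≤rank) (IsPartition.sums partition)
    (All.tail (Linked⇒All {R = _≥_} (λ z≤y y≤x → ≤-trans y≤x z≤y) ≤-refl (IsPartition.nonincrease partition)))

feasibleAux? : ∀ x a r → Dec (feasibleAux x a r)
feasibleAux? x a zero    = a ≤? x
feasibleAux? x a (suc _) = a + 1 ≤? x

FeasibleIn? : ∀ n → Decidable (FeasibleIn n)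
FeasibleIn? n x = ((2 ≤? x) ×-dec (x ≤? n)) ×-dec feasibleAux? x (quotA n x) (remR n x)

-- x = n is feasible since then a = r = 0.
n-feasibleIn : ∀ {n} → 2 ≤ n → FeasibleIn n n
n-feasibleIn {suc zero}    (s≤s ())
n-feasibleIn {suc (suc y)} 2≤n rewrite n∸n≡0 y = (2≤n , ≤-refl) , z≤n

bounded-minimum : ∀ {P : ℕ → Set} (f : ℕ → ℕ) → Decidable P → ∀ {w} N → (∀ s → P s → s ≤ N) → P w →
                  ∃[ m ] IsMinimum P f m
bounded-minimum {P} f P? {w} N bounded Pw =
  f s⋆ , (s⋆ , argmin-all f Pw (all-filter P? (upTo (suc N))) , refl) , minimal
  where
  candidates = filter P? (upTo (suc N))
  s⋆ = argmin f w candidates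
  minimal : ∀ s → P s → f s⋆ ≤ f s
  minimal s Ps = All.lookup (f[argmin]≤f[xs] w candidates) (∈-filter⁺ P? (∈-upTo⁺ (s≤s (bounded s Ps))) Ps)

IsMinimum-transfer : ∀ {A B : Set} {S : A → Set} {T : B → Set} {f : A → ℕ} {g : B → ℕ} {m} →
  IsMinimum S f m → (∀ s → S s → ∃[ t ] T t × g t ≡ f s) → (∀ t → T t → ∃[ s ] S s × f s ≤ g t) →
  IsMinimum T g m
IsMinimum-transfer ((s , Ss , fs≡m) , m≤f) realise bound =
  (let t , Tt , gt≡fs = realise s Ss in t , Tt , trans gt≡fs fs≡m) ,
  λ t Tt → let s′ , Ss′ , fs′≤gt = bound t Tt in ≤-trans (m≤f s′ Ss′) fs′≤gt

theorem2 : (n : ℕ) → 2 ≤ n →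
    Σ ℕ (λ m →
    IsMinimum (λ (λs : List ℕ) → IsPartition n λs × 0ℤ ≤ℤ rank λs) normSq m
    × IsMinimum (λ x → (2 ≤ x × x ≤ n) × Feasible n x) (cost n) m)
theorem2 n 2≤n =
  let m , cost-minimum = bounded-minimum (cost n) (FeasibleIn? n) n (λ _ → proj₂ ∘ proj₁) (n-feasibleIn 2≤n)
  in m , IsMinimum-transfer cost-minimum (partition-of-cost n) (cost-≤-normSq 2≤n) , cost-minimum
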